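{- Let $\mathsf{G}$ be any of the sequent calculi $\mathsf{G.N},\mathsf{G.NN},\mathsf{G.NT},\mathsf{G.NW},\mathsf{G.NC},\mathsf{G.NA},\mathsf{G.NNA}$. The following rules are height-preserving admissible in $\mathsf G$: weakening (from $\Gamma\Rightarrow\Delta$ infer $\Gamma,A\Rightarrow\Delta$, and from $\Gamma\Rightarrow\Delta$ infer $\Gamma\Rightarrow A,\Delta$) and contraction (from $\Gamma,A,A\Rightarrow\Delta$ infer $\Gamma,A\Rightarrow\Delta$, and from $\Gamma\Rightarrow A,A,\Delta$ infer $\Gamma\Rightarrow A,\Delta$).
   Context: Language: formulas $A ::= p \mid \bot \mid A\to A \mid A \preccurlyeq A$ over countably many atoms. Sequents $\Gamma\Rightarrow\Delta$: $\Gamma,\Delta$ finite multisets of formulas. Rules (write $\Sigma^{\preccurlyeq}$ for $C_1\preccurlyeq D_1,\dots,C_n\preccurlyeq D_n$; $\Gamma^{\preccurlyeq}$, $\Delta^{\preccurlyeq}$ for the $\preccurlyeq$-formulas in $\Gamma$, $\Delta$): init: $\Gamma,p\Rightarrow p,\Delta$; $\bot_L$: $\Gamma,\bot\Rightarrow\Delta$; $\to_L$: from $\Gamma\Rightarrow A,\Delta$ and $\Gamma,B\Rightarrow\Delta$ infer $\Gamma,A\to B\Rightarrow\Delta$; $\to_R$: from $\Gamma,A\Rightarrow B,\Delta$ infer $\Gamma\Rightarrow A\to B,\Delta$. $\mathrm{CP}_n$: from $\{C_k\Rightarrow A,D_1,\dots,D_{k-1}\}_{1\le k\le n}$ and $B\Rightarrow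 A,D_1,\dots,D_n$ infer $\Gamma,\Sigma^{\preccurlyeq}\Rightarrow A\preccurlyeq B,\Delta$. $\mathrm N_n$: from $\{C_k\Rightarrow D_1,\dots,D_{k-1}\}_{k\le n}$ and $\Rightarrow D_1,\dots,D_n$ infer $\Gamma,\Sigma^{\preccurlyeq}\Rightarrow\Delta$. $\mathrm T_n$: from $\{C_k\Rightarrow D_1,\dots,D_{k-1}\}_{k\le n}$ and $\Gamma,\Sigma^{\preccurlyeq}\Rightarrow D_1,\dots,D_n,\Delta$ infer $\Gamma,\Sigma^{\preccurlyeq}\Rightarrow\Delta$. $\mathrm W_n$: from $\{C_k\Rightarrow A,D_1,\dots,D_{k-1}\}_{k\le n}$ and $\Gamma,\Sigma^{\preccurlyeq}\Rightarrow A,A\preccurlyeq B,D_1,\dots,D_n,\Delta$ infer $\Gamma,\Sigma^{\preccurlyeq}\Rightarrow A\preccurlyeq B,\Delta$. $\mathrm W_0$: from $\Gamma\Rightarrow A\preccurlyeq B,A,\Delta$ infer $\Gamma\Rightarrow A\preccurlyeq B,\Delta$. $\mathrm C_0$: from $\Gamma,A\preccurlyeq B,A\Rightarrow\Delta$ and $\Gamma,A\preccurlyeq B\Rightarrow B,\Delta$ infer $\Gamma,A\preccurlyeq B\Rightarrow\Delta$. $\mathrm A_n$: from $\{\Gamma^{\preccurlyeq},\Sigma^{\preccurlyeq},C_k\Rightarrow A\preccurlyeq B,A,D_1,\dots,D_{k-1},\Delta^{\preccurlyeq}\}_{k\le n}$ and $\Gamma^{\preccurlyeq},\Sigma^{\preccurlyeq},B\Rightarrow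 A\preccurlyeq B,A,D_1,\dots,D_n,\Delta^{\preccurlyeq}$ infer $\Gamma,\Sigma^{\preccurlyeq}\Rightarrow A\preccurlyeq B,\Delta$. $\mathrm N^A_n$: from $\{\Gamma^{\preccurlyeq},\Sigma^{\preccurlyeq},C_k\Rightarrow D_1,\dots,D_{k-1},\Delta^{\preccurlyeq}\}_{k\le n}$ and $\Gamma^{\preccurlyeq},\Sigma^{\preccurlyeq}\Rightarrow D_1,\dots,D_n,\Delta^{\preccurlyeq}$ infer $\Gamma,\Sigma^{\preccurlyeq}\Rightarrow\Delta$. Calculi: $\mathsf{G.N}=\{\mathrm{init},\bot_L,\to_L,\to_R\}\cup\{\mathrm{CP}_n\mid n\ge0\}$; $\mathsf{G.NN}=\mathsf{G.N}\cup\{\mathrm N_n\mid n\ge1\}$; $\mathsf{G.NT}=\mathsf{G.N}\cup\{\mathrm T_n\mid n\ge1\}$; $\mathsf{G.NW}=\mathsf{G.N}\cup\{\mathrm W_n\mid n\ge0\}\cup\{\mathrm T_n\mid n\ge1\}$; $\mathsf{G.NC}=\mathsf{G.N}\cup\{\mathrm W_0,\mathrm C_0\}$; $\mathsf{G.NA}=\{\mathrm{init},\bot_L,\to_L,\to_R\}\cup\{\mathrm A_n\mid n\ge0\}$; $\mathsf{G.NNA}=\mathsf{G.NA}\cup\{\mathrm N^A_n\mid n\ge1\}$. A rule is height-preserving admissible if whenever its premisses are derivable, its conclusion is derivable with a derivation of at most the same height. -}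

module Defs where

open import Data.Nat using (ℕ; zero; suc; _≤_)
open import Data.Bool using (Bool; true; false; T)
open import Data.Fin using (Fin; toℕ)
open import Data.List using (List; []; _∷_; _++_; [_]; map; take; length; lookup)
open import Data.Product using (_×_; _,_; proj₁; proj₂)
open import Data.List.Relation.Binary.Permutation.Propositional using (_↭_)

infixr 6 _⊃_
infix 7 _≼_
data Fm : Set where
  atom : ℕ → Fm
  ⊥'   : Fm
  _⊃_  : Fm → Fm → Fm
  _≼_  : Fm → Fm → Fm

boxes : List Fm → List Fm
boxes []             = []
boxes (atom _ ∷ Γ)   = boxes Γ
boxes (⊥' ∷ Γ)       = boxes Γ
boxes ((_ ⊃ _) ∷ Γ)  = boxes Γ
boxes ((A ≼ B) ∷ Γ)  = (A ≼ B) ∷ boxes Γ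

Pairs : Set
Pairs = List (Fm × Fm)

prec : Pairs → List Fm
prec = map (λ p → proj₁ p ≼ proj₂ p)

Dall : Pairs → List Fm
Dall = map proj₂

-- for the 0-indexed position k (the paper's index k+1): C_{k+1}
Cat : (Σ : Pairs) → Fin (length Σ) → Fm
Cat Σ k = proj₁ (lookup Σ k)

Dbefore : (Σ : Pairs) → Fin (length Σ) → List Fm
Dbefore Σ k = map proj₂ (take (toℕ k) Σ)

data Calc : Set where
  GN GNN GNT GNW GNC GNA GNNA : Calc

hasCP hasN hasT hasW hasW0C0 hasA hasNA : Calc → Bool
hasCP GN = true
hasCP GNN = true
hasCP GNT = true
hasCP GNW = true
hasCP GNC = true
hasCP GNA = false
hasCP GNNA = false
hasN GNN = true
hasN _ = false
hasT GNT = true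
hasT GNW = true
hasT _ = false
hasW GNW = true
hasW _ = false
hasW0C0 GNC = true
hasW0C0 _ = false
hasA GNA = true
hasA GNNA = true
hasA _ = false
hasNA GNNA = true
hasNA _ = false

-- G ⊢[ n ] Γ ⇒ Δ : the sequent Γ ⇒ Δ has a G-derivation of height ≤ n.
-- Γ, Δ are lists read as multisets: every rule matches its conclusion up to
-- permutation (_↭_).  Initial sequents have height 0 (derivable at any bound),
-- a rule application with premisses of height ≤ n has height ≤ suc n.
infix 3 _⊢[_]_⇒_
data _⊢[_]_⇒_ (G : Calc) : ℕ → List Fm → List Fm → Set where
  init : ∀ {n Γ Δ Γ' Δ' p} → Γ ↭ atom p ∷ Γ' → Δ ↭ atom p ∷ Δ' → G ⊢[ n ] Γ ⇒ Δ
  botL : ∀ {n Γ Δ Γ'} → Γ ↭ ⊥' ∷ Γ' → G ⊢[ n ] Γ ⇒ Δ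
  impL : ∀ {n Γ Δ Γ' A B} → Γ ↭ (A ⊃ B) ∷ Γ' →
         G ⊢[ n ] Γ' ⇒ A ∷ Δ → G ⊢[ n ] B ∷ Γ' ⇒ Δ → G ⊢[ suc n ] Γ ⇒ Δ
  impR : ∀ {n Γ Δ Δ' A B} → Δ ↭ (A ⊃ B) ∷ Δ' →
         G ⊢[ n ] A ∷ Γ ⇒ B ∷ Δ' → G ⊢[ suc n ] Γ ⇒ Δ
  cp   : ∀ {n Γ Δ Γ' Δ' A B} (Σ : Pairs) → T (hasCP G) →
         Γ ↭ Γ' ++ prec Σ → Δ ↭ (A ≼ B) ∷ Δ' →
         (∀ k → G ⊢[ n ] [ Cat Σ k ] ⇒ A ∷ Dbefore Σ k) →
         G ⊢[ n ] [ B ] ⇒ A ∷ Dall Σ →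
         G ⊢[ suc n ] Γ ⇒ Δ
  nn   : ∀ {n Γ Δ Γ'} (Σ : Pairs) → T (hasN G) → 1 ≤ length Σ →
         Γ ↭ Γ' ++ prec Σ →
         (∀ k → G ⊢[ n ] [ Cat Σ k ] ⇒ Dbefore Σ k) →
         G ⊢[ n ] [] ⇒ Dall Σ →
         G ⊢[ suc n ] Γ ⇒ Δ
  tt   : ∀ {n Γ Δ Γ'} (Σ : Pairs) → T (hasT G) → 1 ≤ length Σ →
         Γ ↭ Γ' ++ prec Σ →
         (∀ k → G ⊢[ n ] [ Cat Σ k ] ⇒ Dbefore Σ k) →
         G ⊢[ n ] Γ ⇒ Dall Σ ++ Δ →
         G ⊢[ suc n ] Γ ⇒ Δ
  ww   : ∀ {n Γ Δ Γ' Δ' A B} (Σ : Pairs) → T (hasW G) →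
         Γ ↭ Γ' ++ prec Σ → Δ ↭ (A ≼ B) ∷ Δ' →
         (∀ k → G ⊢[ n ] [ Cat Σ k ] ⇒ A ∷ Dbefore Σ k) →
         G ⊢[ n ] Γ ⇒ A ∷ (A ≼ B) ∷ Dall Σ ++ Δ' →
         G ⊢[ suc n ] Γ ⇒ Δ
  w0   : ∀ {n Γ Δ Δ' A B} → T (hasW0C0 G) → Δ ↭ (A ≼ B) ∷ Δ' →
         G ⊢[ n ] Γ ⇒ (A ≼ B) ∷ A ∷ Δ' →
         G ⊢[ suc n ] Γ ⇒ Δ
  c0   : ∀ {n Γ Δ Γ' A B} → T (hasW0C0 G) → Γ ↭ (A ≼ B) ∷ Γ' →
         G ⊢[ n ] A ∷ Γ ⇒ Δ → G ⊢[ n ] Γ ⇒ B ∷ Δ →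
         G ⊢[ suc n ] Γ ⇒ Δ
  aa   : ∀ {n Γ Δ Γ' Δ' A B} (Σ : Pairs) → T (hasA G) →
         Γ ↭ Γ' ++ prec Σ → Δ ↭ (A ≼ B) ∷ Δ' →
         (∀ k → G ⊢[ n ] boxes Γ' ++ prec Σ ++ [ Cat Σ k ]
                          ⇒ (A ≼ B) ∷ A ∷ Dbefore Σ k ++ boxes Δ') →
         G ⊢[ n ] boxes Γ' ++ prec Σ ++ [ B ] ⇒ (A ≼ B) ∷ A ∷ Dall Σ ++ boxes Δ' →
         G ⊢[ suc n ] Γ ⇒ Δ
  na   : ∀ {n Γ Δ Γ'} (Σ : Pairs) → T (hasNA G) → 1 ≤ length Σ →
         Γ ↭ Γ' ++ prec Σ →
         (∀ k → G ⊢[ n ] boxes Γ' ++ prec Σ ++ [ Cat Σ k ] ⇒ Dbefore Σ k ++ boxes Δ) →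
         G ⊢[ n ] boxes Γ' ++ prec Σ ⇒ Dall Σ ++ boxes Δ →
         G ⊢[ suc n ] Γ ⇒ Δ

-- Weakening and contraction are instances of one monotonicity property. Read a sequent as
-- the set of valuations refuting it, and let S ⊑ S′ say that every refutation of S′ makes
-- the antecedent of S true and its succedent false, where an implication may also be judged
-- through its components. Inclusion of underlying sets, hence weakening and contraction, is
-- a special case. Height-bounded derivability is monotone along ⊑, by induction on the
-- derivation: an implication covered by S′ only through its components is discharged by the
-- matching premise of ⊃L or ⊃R, one level lower (invertibility of these rules in disguise);
-- every other principal formula, in particular each C ≼ D of Σ, occurs in S′ itself, and the
-- rule is reapplied in S′ after deleting repeated pairs from Σ. Keeping first occurrences,
-- each new premise is an old one whose succedent has the same formulas up to order and
-- repetition, so it is again covered by the induction hypothesis.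

module Submission where

open import Defs
open import Data.Bool using (T)
open import Data.Nat as ℕ using (ℕ; suc; _≤_; s≤s; z≤n)
open import Data.Unit using (⊤)
open import Data.Fin using (zero; suc)
open import Data.List using (List; []; _∷_; _++_; [_]; length; filter; deduplicate)
open import Data.List.Properties using (++-identityʳ; ++-assoc)
open import Data.List.Membership.Propositional using (_∈_)
open import Data.List.Membership.Propositional.Properties
  using (∈-∃++; ∈-++⁻; ∈-++⁺ˡ; ∈-++⁺ʳ; ∈-map⁻; ∈-deduplicate⁺; ∈-deduplicate⁻)
open import Data.List.Relation.Unary.Any using (here; there)
open import Data.List.Relation.Unary.All using (lookup)
open import Data.List.Relation.Unary.Unique.Propositional using (Unique; []; _∷_)
open import Data.List.Relation.Unary.Unique.DecPropositional.Properties using (deduplicate-!)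
open import Data.List.Relation.Unary.Unique.Propositional.Properties
  using () renaming (map⁺ to Unique-map⁺)
open import Data.List.Relation.Binary.Subset.Propositional using (_⊆_)
open import Data.List.Relation.Binary.Subset.Propositional.Properties as ⊆
  using (⊆-refl; ⊆-trans; ⊆-reflexive; ⊆-reflexive-↭; xs⊆x∷xs; ∷⁺ʳ)
open import Data.List.Relation.Binary.Permutation.Propositional
  using (_↭_; ↭-sym; ↭-trans; prep)
open import Data.List.Relation.Binary.Permutation.Propositional.Properties as ↭
  using (∈-resp-↭; shift)
open import Data.Product using (_×_; _,_; proj₁; proj₂; ∃; map₂)
import Data.Product.Properties as Product
open import Data.Sum using (inj₁; inj₂; [_,_]′)
open import Function using (_∘_)
open import Relation.Binary.Definitions using (DecidableEquality)
open import Relation.Binary.PropositionalEquality using (_≢_; refl; sym; cong; cong₂)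
open import Relation.Nullary using (yes; no; ¬?; contradiction)
open import Relation.Nullary.Decidable using (map′; _×-dec_)

infix 4 _≟_ _≟ₚ_

_≟_ : DecidableEquality Fm
atom p ≟ atom q = map′ (cong atom) (λ { refl → refl }) (p ℕ.≟ q)
⊥' ≟ ⊥' = yes refl
(A ⊃ B) ≟ (C ⊃ D) = map′ (λ (p , q) → cong₂ _⊃_ p q) (λ { refl → refl , refl }) (A ≟ C ×-dec B ≟ D)
(A ≼ B) ≟ (C ≼ D) = map′ (λ (p , q) → cong₂ _≼_ p q) (λ { refl → refl , refl }) (A ≟ C ×-dec B ≟ D)
atom _ ≟ ⊥' = no λ ()
atom _ ≟ (_ ⊃ _) = no λ ()
atom _ ≟ (_ ≼ _) = no λ ()
⊥' ≟ atom _ = no λ ()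
⊥' ≟ (_ ⊃ _) = no λ ()
⊥' ≟ (_ ≼ _) = no λ ()
(_ ⊃ _) ≟ atom _ = no λ ()
(_ ⊃ _) ≟ ⊥' = no λ ()
(_ ⊃ _) ≟ (_ ≼ _) = no λ ()
(_ ≼ _) ≟ atom _ = no λ ()
(_ ≼ _) ≟ ⊥' = no λ ()
(_ ≼ _) ≟ (_ ⊃ _) = no λ ()

_≟ₚ_ : DecidableEquality (Fm × Fm)
_≟ₚ_ = Product.≡-dec _≟_ _≟_

∈⇒↭∷ : ∀ {A : Set} {x : A} {xs} → x ∈ xs → ∃ λ ys → xs ↭ x ∷ ys
∈⇒↭∷ x∈xs with ∈-∃++ x∈xs
... | ys , zs , refl = ys ++ zs , shift _ ys zs

∷-++-↭ : ∀ {A : Set} {x : A} xs {ys zs} → ys ↭ x ∷ zs → x ∷ xs ++ zs ↭ xs ++ ys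
∷-++-↭ {x = x} xs {zs = zs} p = ↭-trans (↭-sym (shift x xs zs)) (↭.++⁺ˡ xs (↭-sym p))

↭∷⇒⊆ : ∀ {A : Set} {x : A} {xs ys} → xs ↭ x ∷ ys → ys ⊆ xs
↭∷⇒⊆ p = ∈-resp-↭ (↭-sym p) ∘ there

∈∷-≢⇒∈ : ∀ {A : Set} {x y : A} {ys} → x ≢ y → y ∈ x ∷ ys → y ∈ ys
∈∷-≢⇒∈ x≢y (here refl) = contradiction refl x≢y
∈∷-≢⇒∈ _ (there y∈ys) = y∈ys

↭∷⇒∈ : ∀ {A : Set} {x : A} {xs ys} → xs ↭ x ∷ ys → x ∈ xs
↭∷⇒∈ p = ∈-resp-↭ (↭-sym p) (here refl)

++-⊆-tail : ∀ {A : Set} xs ys us vs (zs : List A) →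
            xs ++ ys ⊆ us ++ vs → xs ++ ys ++ zs ⊆ us ++ vs ++ zs
++-⊆-tail xs ys us vs zs s =
  ⊆-trans (⊆-reflexive (sym (++-assoc xs ys zs)))
    (⊆-trans (⊆.++⁺ˡ zs s) (⊆-reflexive (++-assoc us vs zs)))

∷-++-absorb : ∀ {A : Set} {x : A} xs {ys zs} → ys ⊆ x ∷ zs → x ∷ xs ++ ys ⊆ x ∷ xs ++ zs
∷-++-absorb xs s (here refl) = here refl
∷-++-absorb xs s (there m) with ∈-++⁻ xs m
... | inj₁ m′ = there (∈-++⁺ˡ m′)
... | inj₂ m′ with s m′
...   | here refl = here refl
...   | there m″ = there (∈-++⁺ʳ xs m″)

unique-⊆⇒↭ : ∀ {A : Set} {xs ys : List A} → Unique xs → xs ⊆ ys → ∃ λ zs → ys ↭ zs ++ xs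
unique-⊆⇒↭ {ys = ys} [] _ = ys , ↭-sym (↭.++-identityʳ ys)
unique-⊆⇒↭ {xs = x ∷ xs} (x∉xs ∷ u) sub with ∈⇒↭∷ (sub (here refl))
... | ys′ , p with unique-⊆⇒↭ u (λ y∈xs → ∈∷-≢⇒∈ (lookup x∉xs y∈xs) (∈-resp-↭ p (sub (there y∈xs))))
...   | zs , q = zs , ↭-trans p (↭-trans (prep x q) (↭-sym (shift x zs xs)))

data IsBox : Fm → Set where
  box : ∀ {A B} → IsBox (A ≼ B)

∈-boxes⁻ : ∀ {A} L → A ∈ boxes L → IsBox A × A ∈ L
∈-boxes⁻ (atom _ ∷ L) m = map₂ there (∈-boxes⁻ L m)
∈-boxes⁻ (⊥' ∷ L) m = map₂ there (∈-boxes⁻ L m)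
∈-boxes⁻ ((_ ⊃ _) ∷ L) m = map₂ there (∈-boxes⁻ L m)
∈-boxes⁻ ((_ ≼ _) ∷ L) (here refl) = box , here refl
∈-boxes⁻ ((_ ≼ _) ∷ L) (there m) = map₂ there (∈-boxes⁻ L m)

∈-boxes⁺ : ∀ {A L} → IsBox A → A ∈ L → A ∈ boxes L
∈-boxes⁺ box (here refl) = here refl
∈-boxes⁺ {L = atom _ ∷ _} b (there m) = ∈-boxes⁺ b m
∈-boxes⁺ {L = ⊥' ∷ _} b (there m) = ∈-boxes⁺ b m
∈-boxes⁺ {L = (_ ⊃ _) ∷ _} b (there m) = ∈-boxes⁺ b m
∈-boxes⁺ {L = (_ ≼ _) ∷ _} b (there m) = there (∈-boxes⁺ b m)

boxes-mono : ∀ {L M} → L ⊆ M → boxes L ⊆ boxes M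
boxes-mono L⊆M {A} m with ∈-boxes⁻ _ m
... | b , A∈L = ∈-boxes⁺ b (L⊆M A∈L)

∈-prec⇒IsBox : ∀ {A} Σ → A ∈ prec Σ → IsBox A
∈-prec⇒IsBox Σ m with ∈-map⁻ _ m
... | _ , _ , refl = box

∈-boxes++⁺ : ∀ {A} M R → IsBox A → A ∈ M ++ R → A ∈ boxes M ++ R
∈-boxes++⁺ M R b m with ∈-++⁻ M m
... | inj₁ m′ = ∈-++⁺ˡ (∈-boxes⁺ b m′)
... | inj₂ m′ = ∈-++⁺ʳ (boxes M) m′

∈-boxes++prec⁻ : ∀ {A} L Σ → A ∈ boxes L ++ prec Σ → IsBox A × A ∈ L ++ prec Σ
∈-boxes++prec⁻ L Σ m with ∈-++⁻ (boxes L) m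
... | inj₁ m′ = map₂ ∈-++⁺ˡ (∈-boxes⁻ L m′)
... | inj₂ m′ = ∈-prec⇒IsBox Σ m′ , ∈-++⁺ʳ L m′

dedup : Pairs → Pairs
dedup = deduplicate _≟ₚ_

dedup-⊆ : ∀ Σ → dedup Σ ⊆ Σ
dedup-⊆ = ∈-deduplicate⁻ _≟ₚ_

⊆-dedup : ∀ {Σ} → Σ ⊆ dedup Σ
⊆-dedup = ∈-deduplicate⁺ _≟ₚ_

dedup-nonempty : ∀ Σ → 1 ≤ length Σ → 1 ≤ length (dedup Σ)
dedup-nonempty (_ ∷ _) _ = s≤s z≤n

Dall-dedup : ∀ Σ → Dall Σ ⊆ Dall (dedup Σ)
Dall-dedup Σ = ⊆.map⁺ proj₂ ⊆-dedup

prec-dedup-unique : ∀ Σ → Unique (prec (dedup Σ))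
prec-dedup-unique Σ = Unique-map⁺ (λ { {_ , _} {_ , _} refl → refl }) (deduplicate-! _≟ₚ_ Σ)

module _ (P : Fm → List Fm → Set) (P-mono : ∀ {C L M} → L ⊆ M → P C L → P C M) where

  private
    Chain : List Fm → Pairs → Set
    Chain acc [] = ⊤
    Chain acc ((C , D) ∷ Σ) = P C acc × Chain (D ∷ acc) Σ

    chain-mono : ∀ {acc acc′} Σ → acc ⊆ acc′ → Chain acc Σ → Chain acc′ Σ
    chain-mono [] _ _ = _
    chain-mono ((C , D) ∷ Σ) s (p , ps) = P-mono s p , chain-mono Σ (∷⁺ʳ D s) ps

    chain-filter : ∀ {acc C D} Σ → D ∈ acc → Chain acc Σ → Chain acc (filter (¬? ∘ ((C , D) ≟ₚ_)) Σ)
    chain-filter [] _ _ = _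
    chain-filter {acc} {C} {D} ((C′ , D′) ∷ Σ) D∈acc (p , ps) with (C , D) ≟ₚ (C′ , D′)
    ... | yes refl = chain-filter Σ D∈acc (chain-mono Σ (⊆.∈-∷⁺ʳ D∈acc ⊆-refl) ps)
    ... | no _ = p , chain-filter Σ (there D∈acc) ps

    chain-dedup : ∀ {acc} Σ → Chain acc Σ → Chain acc (dedup Σ)
    chain-dedup [] _ = _
    chain-dedup ((C , D) ∷ Σ) (p , ps) = p , chain-filter (dedup Σ) (here refl) (chain-dedup Σ ps)

    toChain : ∀ {acc} Σ → (∀ k → P (Cat Σ k) (acc ++ Dbefore Σ k)) → Chain acc Σ
    toChain [] _ = _
    toChain {acc} ((C , D) ∷ Σ) f =
      P-mono (⊆-reflexive (++-identityʳ acc)) (f zero) ,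
      toChain Σ (λ k → P-mono (⊆-reflexive-↭ (shift D acc _)) (f (suc k)))

    fromChain : ∀ {acc} Σ → Chain acc Σ → ∀ k → P (Cat Σ k) (acc ++ Dbefore Σ k)
    fromChain {acc} ((C , D) ∷ Σ) (p , ps) zero = P-mono (⊆-reflexive (sym (++-identityʳ acc))) p
    fromChain {acc} ((C , D) ∷ Σ) (p , ps) (suc k) =
      P-mono (⊆-reflexive-↭ (↭-sym (shift D acc _))) (fromChain Σ ps k)

  premises-dedup : ∀ Σ → (∀ k → P (Cat Σ k) (Dbefore Σ k)) →
                   ∀ k → P (Cat (dedup Σ) k) (Dbefore (dedup Σ) k)
  premises-dedup Σ = fromChain (dedup Σ) ∘ chain-dedup Σ ∘ toChain Σ

Sequent : Set
Sequent = List Fm × List Fm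

-- Sufficient conditions for A to be true (false) in every valuation refuting S.
mutual
  data TrueIn (S : Sequent) : Fm → Set where
    ∈-ante : ∀ {A} → A ∈ proj₁ S → TrueIn S A
    ⊃-ant : ∀ {A B} → FalseIn S A → TrueIn S (A ⊃ B)
    ⊃-con : ∀ {A B} → TrueIn S B → TrueIn S (A ⊃ B)

  data FalseIn (S : Sequent) : Fm → Set where
    ∈-succ : ∀ {A} → A ∈ proj₂ S → FalseIn S A
    ⊃-false : ∀ {A B} → TrueIn S A → FalseIn S B → FalseIn S (A ⊃ B)

infix 4 _⊑_
_⊑_ : Sequent → Sequent → Set
(Γ , Δ) ⊑ S′ = (∀ {A} → A ∈ Γ → TrueIn S′ A) × (∀ {A} → A ∈ Δ → FalseIn S′ A)

mutual
  TrueIn-⊑ : ∀ {S S′ A} → S ⊑ S′ → TrueIn S A → TrueIn S′ A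
  TrueIn-⊑ σ (∈-ante m) = proj₁ σ m
  TrueIn-⊑ σ (⊃-ant f) = ⊃-ant (FalseIn-⊑ σ f)
  TrueIn-⊑ σ (⊃-con t) = ⊃-con (TrueIn-⊑ σ t)

  FalseIn-⊑ : ∀ {S S′ A} → S ⊑ S′ → FalseIn S A → FalseIn S′ A
  FalseIn-⊑ σ (∈-succ m) = proj₂ σ m
  FalseIn-⊑ σ (⊃-false t f) = ⊃-false (TrueIn-⊑ σ t) (FalseIn-⊑ σ f)

⊑-trans : ∀ {S S′ S″} → S ⊑ S′ → S′ ⊑ S″ → S ⊑ S″
⊑-trans (l , r) τ = TrueIn-⊑ τ ∘ l , FalseIn-⊑ τ ∘ r

⊆⇒⊑ : ∀ {Γ Δ Γ₂ Δ₂} → Γ ⊆ Γ₂ → Δ ⊆ Δ₂ → (Γ , Δ) ⊑ (Γ₂ , Δ₂)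
⊆⇒⊑ sˡ sʳ = ∈-ante ∘ sˡ , ∈-succ ∘ sʳ

⊆-⊑ : ∀ {Γ Δ Γ₁ Δ₁ S′} → Γ ⊆ Γ₁ → Δ ⊆ Δ₁ → (Γ₁ , Δ₁) ⊑ S′ → (Γ , Δ) ⊑ S′
⊆-⊑ sˡ sʳ σ = ⊑-trans (⊆⇒⊑ sˡ sʳ) σ

⊑-⊆ : ∀ {S Γ₂ Δ₂ Γ₃ Δ₃} → Γ₂ ⊆ Γ₃ → Δ₂ ⊆ Δ₃ → S ⊑ (Γ₂ , Δ₂) → S ⊑ (Γ₃ , Δ₃)
⊑-⊆ sˡ sʳ σ = ⊑-trans σ (⊆⇒⊑ sˡ sʳ)

∷ˡ-⊑ : ∀ {Γ Δ S′ A} → TrueIn S′ A → (Γ , Δ) ⊑ S′ → (A ∷ Γ , Δ) ⊑ S′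
∷ˡ-⊑ t (l , r) = (λ { (here refl) → t ; (there m) → l m }) , r

∷ʳ-⊑ : ∀ {Γ Δ S′ A} → FalseIn S′ A → (Γ , Δ) ⊑ S′ → (Γ , A ∷ Δ) ⊑ S′
∷ʳ-⊑ f (l , r) = l , λ { (here refl) → f ; (there m) → r m }

⊑-∷⁺ˡ : ∀ {Γ Δ Γ₂ Δ₂ A} → (Γ , Δ) ⊑ (Γ₂ , Δ₂) → (A ∷ Γ , Δ) ⊑ (A ∷ Γ₂ , Δ₂)
⊑-∷⁺ˡ {A = A} σ = ∷ˡ-⊑ (∈-ante (here refl)) (⊑-⊆ (xs⊆x∷xs _ A) ⊆-refl σ)

⊑-∷⁺ʳ : ∀ {Γ Δ Γ₂ Δ₂ A} → (Γ , Δ) ⊑ (Γ₂ , Δ₂) → (Γ , A ∷ Δ) ⊑ (Γ₂ , A ∷ Δ₂)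
⊑-∷⁺ʳ {A = A} σ = ∷ʳ-⊑ (∈-succ (here refl)) (⊑-⊆ ⊆-refl (xs⊆x∷xs _ A) σ)

⊑-++⁺ʳ : ∀ {Γ Δ Γ₂ Δ₂ L L₂} → L ⊆ L₂ → (Γ , Δ) ⊑ (Γ₂ , Δ₂) → (Γ , L ++ Δ) ⊑ (Γ₂ , L₂ ++ Δ₂)
⊑-++⁺ʳ {L = L} {L₂} s σ with ⊑-⊆ ⊆-refl (⊆.xs⊆ys++xs _ L₂) σ
... | l , r = l , λ m → [ ∈-succ ∘ ∈-++⁺ˡ ∘ s , r ]′ (∈-++⁻ L m)

TrueIn⇒∈ : ∀ {Γ Δ A} → (∀ {B C} → A ≢ B ⊃ C) → TrueIn (Γ , Δ) A → A ∈ Γ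
TrueIn⇒∈ _ (∈-ante m) = m
TrueIn⇒∈ A≢⊃ (⊃-ant _) = contradiction refl A≢⊃
TrueIn⇒∈ A≢⊃ (⊃-con _) = contradiction refl A≢⊃

FalseIn⇒∈ : ∀ {Γ Δ A} → (∀ {B C} → A ≢ B ⊃ C) → FalseIn (Γ , Δ) A → A ∈ Δ
FalseIn⇒∈ _ (∈-succ m) = m
FalseIn⇒∈ A≢⊃ (⊃-false _ _) = contradiction refl A≢⊃

box≢⊃ : ∀ {A} → IsBox A → ∀ {B C} → A ≢ B ⊃ C
box≢⊃ box ()

principal-ante : ∀ {Γ Δ Γ₂ Δ₂ Γ′ A} → (∀ {B C} → A ≢ B ⊃ C) → (Γ , Δ) ⊑ (Γ₂ , Δ₂) →
         Γ ↭ A ∷ Γ′ → ∃ λ Γ₂′ → Γ₂ ↭ A ∷ Γ₂′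
principal-ante A≢⊃ σ p = ∈⇒↭∷ (TrueIn⇒∈ A≢⊃ (proj₁ σ (↭∷⇒∈ p)))

principal-succ : ∀ {Γ Δ Γ₂ Δ₂ Δ′ A} → (∀ {B C} → A ≢ B ⊃ C) → (Γ , Δ) ⊑ (Γ₂ , Δ₂) →
         Δ ↭ A ∷ Δ′ → ∃ λ Δ₂′ → Δ₂ ↭ A ∷ Δ₂′
principal-succ A≢⊃ σ p = ∈⇒↭∷ (FalseIn⇒∈ A≢⊃ (proj₂ σ (↭∷⇒∈ p)))

principal-prec : ∀ {Γ Δ Γ₂ Δ₂ Γ′} Σ → (Γ , Δ) ⊑ (Γ₂ , Δ₂) →
         Γ ↭ Γ′ ++ prec Σ → ∃ λ Γ₂′ → Γ₂ ↭ Γ₂′ ++ prec (dedup Σ)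
principal-prec Σ σ p = unique-⊆⇒↭ (prec-dedup-unique Σ) λ m →
  TrueIn⇒∈ (box≢⊃ (∈-prec⇒IsBox (dedup Σ) m))
    (proj₁ σ (∈-resp-↭ (↭-sym p) (∈-++⁺ʳ _ (⊆.map⁺ _ (dedup-⊆ Σ) m))))

boxes-ante-⊆ : ∀ {Γ Δ Γ₂ Δ₂ Γ′ Γ₂′} Σ Σ₂ → (Γ , Δ) ⊑ (Γ₂ , Δ₂) →
               Γ ↭ Γ′ ++ prec Σ → Γ₂ ↭ Γ₂′ ++ prec Σ₂ → boxes Γ′ ++ prec Σ ⊆ boxes Γ₂′ ++ prec Σ₂
boxes-ante-⊆ {Γ′ = Γ′} {Γ₂′} Σ Σ₂ σ p p₂ m with ∈-boxes++prec⁻ Γ′ Σ m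
... | b , m′ = ∈-boxes++⁺ Γ₂′ (prec Σ₂) b
                 (∈-resp-↭ p₂ (TrueIn⇒∈ (box≢⊃ b) (proj₁ σ (∈-resp-↭ (↭-sym p) m′))))

boxes-succ-⊆ : ∀ {Γ Δ Γ₂ Δ₂} → (Γ , Δ) ⊑ (Γ₂ , Δ₂) → boxes Δ ⊆ boxes Δ₂
boxes-succ-⊆ {Δ = Δ} σ m with ∈-boxes⁻ Δ m
... | b , m′ = ∈-boxes⁺ b (FalseIn⇒∈ (box≢⊃ b) (proj₂ σ m′))

⊢-raise : ∀ {G n Γ Δ} → G ⊢[ n ] Γ ⇒ Δ → G ⊢[ suc n ] Γ ⇒ Δ
⊢-raise (init p q) = init p q
⊢-raise (botL p) = botL p
⊢-raise (impL p d e) = impL p (⊢-raise d) (⊢-raise e)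
⊢-raise (impR p d) = impR p (⊢-raise d)
⊢-raise (cp Σ h p q ps d) = cp Σ h p q (⊢-raise ∘ ps) (⊢-raise d)
⊢-raise (nn Σ h l p ps d) = nn Σ h l p (⊢-raise ∘ ps) (⊢-raise d)
⊢-raise (tt Σ h l p ps d) = tt Σ h l p (⊢-raise ∘ ps) (⊢-raise d)
⊢-raise (ww Σ h p q ps d) = ww Σ h p q (⊢-raise ∘ ps) (⊢-raise d)
⊢-raise (w0 h q d) = w0 h q (⊢-raise d)
⊢-raise (c0 h p d e) = c0 h p (⊢-raise d) (⊢-raise e)
⊢-raise (aa Σ h p q ps d) = aa Σ h p q (⊢-raise ∘ ps) (⊢-raise d)
⊢-raise (na Σ h l p ps d) = na Σ h l p (⊢-raise ∘ ps) (⊢-raise d)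

Monotone : Calc → ℕ → Set
Monotone G n = ∀ {Γ Δ Γ₂ Δ₂} → (Γ , Δ) ⊑ (Γ₂ , Δ₂) → G ⊢[ n ] Γ ⇒ Δ → G ⊢[ n ] Γ₂ ⇒ Δ₂

impL-mono : ∀ {G m Γ Δ Γ₂ Δ₂ Γ′ A B} → Monotone G m → (Γ , Δ) ⊑ (Γ₂ , Δ₂) →
            Γ ↭ (A ⊃ B) ∷ Γ′ → G ⊢[ m ] Γ′ ⇒ A ∷ Δ → G ⊢[ m ] B ∷ Γ′ ⇒ Δ →
            G ⊢[ suc m ] Γ₂ ⇒ Δ₂
impL-mono {Δ = Δ} {Γ₂} {Δ₂} {Γ′} {A} {B} mono σ p d e with proj₁ σ (↭∷⇒∈ p)
... | ⊃-ant f = ⊢-raise (mono (∷ʳ-⊑ f (⊆-⊑ (↭∷⇒⊆ p) ⊆-refl σ)) d)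
... | ⊃-con t = ⊢-raise (mono (∷ˡ-⊑ t (⊆-⊑ (↭∷⇒⊆ p) ⊆-refl σ)) e)
... | ∈-ante m with ∈⇒↭∷ m
...   | Γ₂′ , p₂ = impL p₂ (mono σ₁ d) (mono σ₂ e)
  where
  σ′ : (Γ′ , Δ) ⊑ (Γ₂ , Δ₂)
  σ′ = ⊆-⊑ (↭∷⇒⊆ p) ⊆-refl σ
  σ₁ : (Γ′ , A ∷ Δ) ⊑ (Γ₂′ , A ∷ Δ₂)
  σ₁ = ∷ʳ-⊑ (∈-succ (here refl)) (⊑-trans σ′ (⊆-⊑ (⊆-reflexive-↭ p₂) ⊆-refl
         (∷ˡ-⊑ (⊃-ant (∈-succ (here refl))) (⊆⇒⊑ ⊆-refl (xs⊆x∷xs _ A)))))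
  σ₂ : (B ∷ Γ′ , Δ) ⊑ (B ∷ Γ₂′ , Δ₂)
  σ₂ = ∷ˡ-⊑ (∈-ante (here refl)) (⊑-trans σ′ (⊆-⊑ (⊆-reflexive-↭ p₂) ⊆-refl
         (∷ˡ-⊑ (⊃-con (∈-ante (here refl))) (⊆⇒⊑ (xs⊆x∷xs _ B) ⊆-refl))))

impR-mono : ∀ {G m Γ Δ Γ₂ Δ₂ Δ′ A B} → Monotone G m → (Γ , Δ) ⊑ (Γ₂ , Δ₂) →
            Δ ↭ (A ⊃ B) ∷ Δ′ → G ⊢[ m ] A ∷ Γ ⇒ B ∷ Δ′ → G ⊢[ suc m ] Γ₂ ⇒ Δ₂
impR-mono {Γ = Γ} {Γ₂ = Γ₂} {Δ′ = Δ′} {A} {B} mono σ q d with proj₂ σ (↭∷⇒∈ q)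
... | ⊃-false t f = ⊢-raise (mono (∷ˡ-⊑ t (∷ʳ-⊑ f (⊆-⊑ ⊆-refl (↭∷⇒⊆ q) σ))) d)
... | ∈-succ m with ∈⇒↭∷ m
...   | Δ₂′ , q₂ = impR q₂ (mono σ₁ d)
  where
  σ₁ : (A ∷ Γ , B ∷ Δ′) ⊑ (A ∷ Γ₂ , B ∷ Δ₂′)
  σ₁ = ∷ˡ-⊑ (∈-ante (here refl)) (∷ʳ-⊑ (∈-succ (here refl)) (⊑-trans (⊆-⊑ ⊆-refl (↭∷⇒⊆ q) σ)
         (⊆-⊑ ⊆-refl (⊆-reflexive-↭ q₂)
           (∷ʳ-⊑ (⊃-false (∈-ante (here refl)) (∈-succ (here refl)))
             (⊆⇒⊑ (xs⊆x∷xs _ A) (xs⊆x∷xs _ B))))))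

singleton-premises-dedup : ∀ {G m} → Monotone G m → ∀ pre Σ →
  (∀ k → G ⊢[ m ] [ Cat Σ k ] ⇒ pre ++ Dbefore Σ k) →
  ∀ k → G ⊢[ m ] [ Cat (dedup Σ) k ] ⇒ pre ++ Dbefore (dedup Σ) k
singleton-premises-dedup {G} {m} mono pre =
  premises-dedup (λ C L → G ⊢[ m ] [ C ] ⇒ pre ++ L) (mono ∘ ⊆⇒⊑ ⊆-refl ∘ ⊆.++⁺ʳ pre)

aa-mono : ∀ {G m Γ Δ Γ₂ Δ₂ Γ′ Δ′ A B} Σ → Monotone G m → (Γ , Δ) ⊑ (Γ₂ , Δ₂) →
          T (hasA G) → Γ ↭ Γ′ ++ prec Σ → Δ ↭ (A ≼ B) ∷ Δ′ →
          (∀ k → G ⊢[ m ] boxes Γ′ ++ prec Σ ++ [ Cat Σ k ]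
                         ⇒ (A ≼ B) ∷ A ∷ Dbefore Σ k ++ boxes Δ′) →
          G ⊢[ m ] boxes Γ′ ++ prec Σ ++ [ B ] ⇒ (A ≼ B) ∷ A ∷ Dall Σ ++ boxes Δ′ →
          G ⊢[ suc m ] Γ₂ ⇒ Δ₂
aa-mono {G} {m} {Γ′ = Γ′} {Δ′} {A} {B} Σ mono σ h p q ps d
  with principal-prec Σ σ p | principal-succ (λ ()) σ q
... | Γ₂′ , p₂ | Δ₂′ , q₂ =
  aa (dedup Σ) h p₂ q₂
    (premises-dedup
      (λ C L → G ⊢[ m ] boxes Γ₂′ ++ prec (dedup Σ) ++ [ C ] ⇒ (A ≼ B) ∷ A ∷ L ++ boxes Δ₂′)
      (mono ∘ ⊆⇒⊑ ⊆-refl ∘ ∷⁺ʳ _ ∘ ∷⁺ʳ A ∘ ⊆.++⁺ˡ _) Σ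
      (λ k → mono (⊆⇒⊑ (ante _) (succ _)) (ps k)))
    (mono (⊆⇒⊑ (ante _) (⊆-trans (succ _) (∷⁺ʳ _ (∷⁺ʳ A (⊆.++⁺ˡ _ (Dall-dedup Σ)))))) d)
  where
  ante : ∀ L → boxes Γ′ ++ prec Σ ++ L ⊆ boxes Γ₂′ ++ prec (dedup Σ) ++ L
  ante L = ++-⊆-tail (boxes Γ′) (prec Σ) (boxes Γ₂′) (prec (dedup Σ)) L
             (boxes-ante-⊆ Σ (dedup Σ) σ p p₂)
  succ : ∀ L → (A ≼ B) ∷ A ∷ L ++ boxes Δ′ ⊆ (A ≼ B) ∷ A ∷ L ++ boxes Δ₂′
  succ L = ∷-++-absorb (A ∷ L)
    (⊆-trans (boxes-mono (↭∷⇒⊆ q)) (⊆-trans (boxes-succ-⊆ σ) (boxes-mono (⊆-reflexive-↭ q₂))))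

na-mono : ∀ {G m Γ Δ Γ₂ Δ₂ Γ′} Σ → Monotone G m → (Γ , Δ) ⊑ (Γ₂ , Δ₂) →
          T (hasNA G) → 1 ≤ length Σ → Γ ↭ Γ′ ++ prec Σ →
          (∀ k → G ⊢[ m ] boxes Γ′ ++ prec Σ ++ [ Cat Σ k ] ⇒ Dbefore Σ k ++ boxes Δ) →
          G ⊢[ m ] boxes Γ′ ++ prec Σ ⇒ Dall Σ ++ boxes Δ →
          G ⊢[ suc m ] Γ₂ ⇒ Δ₂
na-mono {G} {m} {Δ₂ = Δ₂} {Γ′} Σ mono σ h l p ps d with principal-prec Σ σ p
... | Γ₂′ , p₂ =
  na (dedup Σ) h (dedup-nonempty Σ l) p₂
    (premises-dedup (λ C L → G ⊢[ m ] boxes Γ₂′ ++ prec (dedup Σ) ++ [ C ] ⇒ L ++ boxes Δ₂)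
      (mono ∘ ⊆⇒⊑ ⊆-refl ∘ ⊆.++⁺ˡ _) Σ
      (λ k → mono (⊆⇒⊑ (ante′ [ Cat Σ k ]) (⊆.++⁺ʳ (Dbefore Σ k) (boxes-succ-⊆ σ))) (ps k)))
    (mono (⊆⇒⊑ ante (⊆.++⁺ (Dall-dedup Σ) (boxes-succ-⊆ σ))) d)
  where
  ante : boxes Γ′ ++ prec Σ ⊆ boxes Γ₂′ ++ prec (dedup Σ)
  ante = boxes-ante-⊆ Σ (dedup Σ) σ p p₂
  ante′ : ∀ L → boxes Γ′ ++ prec Σ ++ L ⊆ boxes Γ₂′ ++ prec (dedup Σ) ++ L
  ante′ L = ++-⊆-tail (boxes Γ′) (prec Σ) (boxes Γ₂′) (prec (dedup Σ)) L ante

⊢-mono-⊑ : ∀ {G n} → Monotone G n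
⊢-mono-⊑ σ (init p q) = init (proj₂ (principal-ante (λ ()) σ p)) (proj₂ (principal-succ (λ ()) σ q))
⊢-mono-⊑ σ (botL p) = botL (proj₂ (principal-ante (λ ()) σ p))
⊢-mono-⊑ σ (impL p d e) = impL-mono ⊢-mono-⊑ σ p d e
⊢-mono-⊑ σ (impR q d) = impR-mono ⊢-mono-⊑ σ q d
⊢-mono-⊑ σ (cp {A = A} Σ h p q ps d) with principal-prec Σ σ p | principal-succ (λ ()) σ q
... | _ , p₂ | _ , q₂ = cp (dedup Σ) h p₂ q₂ (singleton-premises-dedup ⊢-mono-⊑ [ A ] Σ ps)
                          (⊢-mono-⊑ (⊆⇒⊑ ⊆-refl (∷⁺ʳ A (Dall-dedup Σ))) d)
⊢-mono-⊑ σ (nn Σ h l p ps d) with principal-prec Σ σ p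
... | _ , p₂ = nn (dedup Σ) h (dedup-nonempty Σ l) p₂ (singleton-premises-dedup ⊢-mono-⊑ [] Σ ps)
                 (⊢-mono-⊑ (⊆⇒⊑ ⊆-refl (Dall-dedup Σ)) d)
⊢-mono-⊑ σ (tt Σ h l p ps d) with principal-prec Σ σ p
... | _ , p₂ = tt (dedup Σ) h (dedup-nonempty Σ l) p₂ (singleton-premises-dedup ⊢-mono-⊑ [] Σ ps)
                 (⊢-mono-⊑ (⊑-++⁺ʳ (Dall-dedup Σ) σ) d)
⊢-mono-⊑ σ (ww {A = A} Σ h p q ps d) with principal-prec Σ σ p | principal-succ (λ ()) σ q
... | _ , p₂ | _ , q₂ =
  ww (dedup Σ) h p₂ q₂ (singleton-premises-dedup ⊢-mono-⊑ [ A ] Σ ps)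
    (⊢-mono-⊑ (⊆-⊑ ⊆-refl (⊆-reflexive-↭ (prep A (∷-++-↭ (Dall Σ) q)))
      (⊑-⊆ ⊆-refl (⊆-reflexive-↭ (↭-sym (prep A (∷-++-↭ _ q₂))))
        (⊑-∷⁺ʳ (⊑-++⁺ʳ (Dall-dedup Σ) σ)))) d)
⊢-mono-⊑ σ (w0 {A = A} h q d) with principal-succ (λ ()) σ q
... | _ , q₂ =
  w0 h q₂ (⊢-mono-⊑ (⊆-⊑ ⊆-refl (⊆-reflexive-↭ (∷-++-↭ [ A ] q))
    (⊑-⊆ ⊆-refl (⊆-reflexive-↭ (↭-sym (∷-++-↭ [ A ] q₂))) (⊑-∷⁺ʳ σ))) d)
⊢-mono-⊑ σ (c0 h p d e) with principal-ante (λ ()) σ p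
... | _ , p₂ = c0 h p₂ (⊢-mono-⊑ (⊑-∷⁺ˡ σ) d) (⊢-mono-⊑ (⊑-∷⁺ʳ σ) e)
⊢-mono-⊑ σ (aa Σ h p q ps d) = aa-mono Σ ⊢-mono-⊑ σ h p q ps d
⊢-mono-⊑ σ (na Σ h l p ps d) = na-mono Σ ⊢-mono-⊑ σ h l p ps d

proposition4p2 : (G : Calc) (n : ℕ) (A : Fm) (Γ Δ : List Fm) →
    ((G ⊢[ n ] Γ ⇒ Δ) → (G ⊢[ n ] A ∷ Γ ⇒ Δ))
    × ((G ⊢[ n ] Γ ⇒ Δ) → (G ⊢[ n ] Γ ⇒ A ∷ Δ))
    × ((G ⊢[ n ] A ∷ A ∷ Γ ⇒ Δ) → (G ⊢[ n ] A ∷ Γ ⇒ Δ))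
    × ((G ⊢[ n ] Γ ⇒ A ∷ A ∷ Δ) → (G ⊢[ n ] Γ ⇒ A ∷ Δ))
proposition4p2 G n A Γ Δ =
  ⊢-mono-⊑ (⊆⇒⊑ (xs⊆x∷xs Γ A) ⊆-refl) ,
  ⊢-mono-⊑ (⊆⇒⊑ ⊆-refl (xs⊆x∷xs Δ A)) ,
  ⊢-mono-⊑ (⊆⇒⊑ contract ⊆-refl) ,
  ⊢-mono-⊑ (⊆⇒⊑ ⊆-refl contract)
  where
  contract : ∀ {L} → A ∷ A ∷ L ⊆ A ∷ L
  contract = ⊆.∈-∷⁺ʳ (here refl) ⊆-refl
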